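{- Let $k\ge 1$ and let $m<n$ be positive integers. Then $f(n)<2^k\cdot f(m)$, where $f(n)=\frac{c_k(n)}{n^k}$.
   Context: $[n]=\{1,\dots,n\}$. A $k$-dimensional corner in $[n]^k$ is a set of the form $\{\mathbf{a}\}\cup\{\mathbf{a}+de_i:1\le i\le k\}\subseteq[n]^k$ with $\mathbf{a}\in[n]^k$, $d>0$ an integer, and $e_1,\dots,e_k$ the standard basis vectors. $c_k(n)$ is the maximum size of a subset of $[n]^k$ containing no $k$-dimensional corner. -}

module Defs where

open import Data.Nat using (ℕ; _+_; _*_; _^_; _≤_; _<_)
open import Data.Fin using (Fin)
open import Data.Vec using (Vec; updateAt)
open import Data.List using (List; length)
open import Data.List.Membership.Propositional using (_∈_)
open import Data.List.Relation.Unary.Unique.Propositional using (Unique)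
import Data.List.Relation.Unary.All as ListAll
import Data.Vec.Relation.Unary.All as VecAll
open import Data.Product using (Σ; ∃; _×_)
open import Relation.Nullary using (¬_)

Point : ℕ → Set
Point k = Vec ℕ k

InGrid : ∀ {k} → ℕ → Point k → Set
InGrid n p = VecAll.All (λ x → 1 ≤ x × x ≤ n) p

-- A finite subset of [n]^k, represented as a duplicate-free list of grid points.
record GridSubset (k n : ℕ) : Set where
  field
    elems  : List (Point k)
    unique : Unique elems
    inGrid : ListAll.All (InGrid n) elems

open GridSubset public

size : ∀ {k n} → GridSubset k n → ℕ
size A = length (elems A)

shift : ∀ {k} → Point k → Fin k → ℕ → Point k
shift a i d = updateAt a i (λ x → x + d)

HasCorner : ∀ {k n} → GridSubset k n → Set
HasCorner {k} A =
  Σ (Point k) λ a → Σ ℕ λ d →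
    (0 < d) × (a ∈ elems A) × ((i : Fin k) → shift a i d ∈ elems A)

CornerFree : ∀ {k n} → GridSubset k n → Set
CornerFree A = ¬ HasCorner A

-- c is the value c_k(n): the maximum size of a corner-free subset of [n]^k.
IsCk : ℕ → ℕ → ℕ → Set
IsCk k n c =
  (Σ (GridSubset k n) λ A → CornerFree A × size A ≡' c)
  × ((A : GridSubset k n) → CornerFree A → size A ≤ c)
  where
  open import Relation.Binary.PropositionalEquality using () renaming (_≡_ to _≡'_)

{-# OPTIONS --safe #-}
-- Cut [n]^k into ⌈n/m⌉^k translates of [m]^k. A corner-free A ⊆ [n]^k meets each translate
-- in a translate of a corner-free subset of [m]^k, so c_k(n) ≤ ⌈n/m⌉^k c_k(m). Since m < n,
-- ⌈n/m⌉ m ≤ m + n − 1 < 2n, and the inequality is strict because c_k(m) ≥ 1 (a single point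
-- contains no corner).
module Submission where

open import Defs
open import Data.Nat using (ℕ; _*_; _^_; _≤_; _<_)
open import Data.Nat as ℕ using (suc; _+_; _∸_; s≤s; NonZero; >-nonZero)
open import Data.Nat.Properties
open import Algebra.Properties.CommutativeSemigroup *-commutativeSemigroup using (xy∙z≈y∙xz)
open import Data.Nat.DivMod using (_/_; _%_; m≡m%n+[m/n]*n; m%n<n; m/n*n≤m; /-monoˡ-≤)
import Data.Fin as Fin
open import Data.Vec as Vec using (Vec; zipWith; replicate)
import Data.Vec.Properties as Vec
import Data.Vec.Relation.Unary.All as VecAll
open import Data.List as List using (List; []; _∷_; [_]; length; filter; upTo; cartesianProductWith)
open import Data.List.Properties using (length-++; length-map; length-upTo)
open import Data.List.Membership.Propositional using (_∈_)
open import Data.List.Membership.Propositional.Properties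
  using (∈-filter⁻; ∈-map⁻; ∈-upTo⁺; ∈-cartesianProductWith⁺)
open import Data.List.Relation.Unary.Any using (here; there)
open import Data.List.Relation.Unary.All as All using (All)
open import Data.List.Relation.Unary.All.Properties using (all-filter; filter⁺; map⁺)
open import Data.List.Relation.Unary.AllPairs using ([]; _∷_)
open import Data.List.Relation.Unary.Unique.Propositional using (Unique)
import Data.List.Relation.Unary.Unique.Propositional.Properties as Unique
open import Data.List.Relation.Binary.Sublist.Propositional.Properties
  using (filter-⊆; length-mono-≤) renaming (filter⁺ to filter⁺-⊆)
open import Data.Product using (_×_; _,_; proj₁; proj₂)
open import Relation.Nullary using (¬_; yes; no; contradiction)
open import Relation.Unary using (Decidable)
open import Relation.Unary.Properties using (∁?)
open import Relation.Binary using (DecidableEquality)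
open import Relation.Binary.PropositionalEquality using (_≡_; refl; sym; trans; cong; cong₂; subst; module ≡-Reasoning)

module _ {A : Set} {P : A → Set} (P? : Decidable P) where

  length-filter-∁ : ∀ xs → length (filter P? xs) + length (filter (∁? P?) xs) ≡ length xs
  length-filter-∁ [] = refl
  length-filter-∁ (x ∷ xs) with P? x
  ... | yes _ = cong suc (length-filter-∁ xs)
  ... | no _  = trans (+-suc _ _) (cong suc (length-filter-∁ xs))

  length-filter-filter : ∀ {Q : A → Set} (Q? : Decidable Q) xs →
    length (filter P? (filter Q? xs)) ≤ length (filter P? xs)
  length-filter-filter Q? xs = length-mono-≤ (filter⁺-⊆ P? P? (λ { refl p → p }) (filter-⊆ Q? xs))

length≤length*fibre : ∀ {A B : Set} (f : A → B) (_≟_ : DecidableEquality B) c ys xs →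
  All (λ x → f x ∈ ys) xs → (∀ y → length (filter (λ x → f x ≟ y) xs) ≤ c) →
  length xs ≤ length ys * c
length≤length*fibre f _≟_ c [] [] _ _ = ℕ.z≤n
length≤length*fibre f _≟_ c [] (x ∷ xs) (() All.∷ _) _
length≤length*fibre {A} f _≟_ c (y ∷ ys) xs f[xs]⊆y∷ys fibre≤c = begin
  length xs                                          ≡⟨ length-filter-∁ (λ x → f x ≟ y) xs ⟨
  length (filter (λ x → f x ≟ y) xs) + length rest   ≤⟨ +-mono-≤ (fibre≤c y) rest-bound ⟩
  c + length ys * c                                  ∎
  where
  open ≤-Reasoning
  rest : List A
  rest = filter (∁? (λ x → f x ≟ y)) xs
  rest-bound : length rest ≤ length ys * c
  rest-bound = length≤length*fibre f _≟_ c ys rest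
    (All.zipWith (λ { (here eq , f[x]≢y) → contradiction eq f[x]≢y ; (there f[x]∈ys , _) → f[x]∈ys })
                 (filter⁺ _ f[xs]⊆y∷ys , all-filter _ xs))
    (λ y′ → ≤-trans (length-filter-filter (λ x → f x ≟ y′) _ xs) (fibre≤c y′))

unique-map⁺ : ∀ {X Y : Set} {f : X → Y} {g : Y → X} {xs} →
  All (λ x → g (f x) ≡ x) xs → Unique xs → Unique (List.map f xs)
unique-map⁺ All.[] [] = []
unique-map⁺ {f = f} {g} (gfx≡x All.∷ gf≡id) (x∉xs ∷ xs!) =
  map⁺ (All.zipWith separate (x∉xs , gf≡id)) ∷ unique-map⁺ {f = f} {g} gf≡id xs!
  where
  separate : ∀ {y} → (¬ _ ≡ y) × g (f y) ≡ y → ¬ f _ ≡ f y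
  separate (x≢y , gfy≡y) fx≡fy = x≢y (trans (sym gfx≡x) (trans (cong g fx≡fy) gfy≡y))

^-distrib-* : ∀ a b k → (a * b) ^ k ≡ a ^ k * b ^ k
^-distrib-* a b ℕ.zero = refl
^-distrib-* a b (suc k) =
  trans (cong (a * b *_) (^-distrib-* a b k)) ([m*n]*[o*p]≡[m*o]*[n*p] a b (a ^ k) (b ^ k))

vectorsBelow : (k q : ℕ) → List (Vec ℕ k)
vectorsBelow ℕ.zero q = [ Vec.[] ]
vectorsBelow (suc k) q = cartesianProductWith Vec._∷_ (upTo q) (vectorsBelow k q)

length-cartesianProductWith : ∀ {A B C : Set} (f : A → B → C) xs ys →
  length (cartesianProductWith f xs ys) ≡ length xs * length ys
length-cartesianProductWith f [] ys = refl
length-cartesianProductWith f (x ∷ xs) ys = begin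
  length (List.map (f x) ys List.++ cartesianProductWith f xs ys)  ≡⟨ length-++ (List.map (f x) ys) ⟩
  length (List.map (f x) ys) + length (cartesianProductWith f xs ys)
    ≡⟨ cong₂ _+_ (length-map (f x) ys) (length-cartesianProductWith f xs ys) ⟩
  length ys + length xs * length ys ∎
  where open ≡-Reasoning

length-vectorsBelow : ∀ k q → length (vectorsBelow k q) ≡ q ^ k
length-vectorsBelow ℕ.zero q = refl
length-vectorsBelow (suc k) q = begin
  length (cartesianProductWith Vec._∷_ (upTo q) (vectorsBelow k q))
    ≡⟨ length-cartesianProductWith Vec._∷_ (upTo q) (vectorsBelow k q) ⟩
  length (upTo q) * length (vectorsBelow k q)
    ≡⟨ cong₂ _*_ (length-upTo q) (length-vectorsBelow k q) ⟩
  q * q ^ k ∎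
  where open ≡-Reasoning

∈-vectorsBelow : ∀ {k q} {v : Vec ℕ k} → VecAll.All (_< q) v → v ∈ vectorsBelow k q
∈-vectorsBelow VecAll.[] = here refl
∈-vectorsBelow (x<q VecAll.∷ v<q) = ∈-cartesianProductWith⁺ Vec._∷_ (∈-upTo⁺ x<q) (∈-vectorsBelow v<q)

-- Coordinates are 1-based: x = block x * m + offset x with 1 ≤ offset x ≤ m,
-- so [n] is covered by suc (block n) = ⌈n/m⌉ blocks.
module Blocks (m : ℕ) .{{_ : NonZero m}} where

  block : ℕ → ℕ
  block x = (x ∸ 1) / m

  offset : ℕ → ℕ
  offset x = suc ((x ∸ 1) % m)

  block*m+offset : ∀ {x} → 1 ≤ x → block x * m + offset x ≡ x
  block*m+offset {suc x} _ = begin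
    x / m * m + suc (x % m)  ≡⟨ +-suc (x / m * m) (x % m) ⟩
    suc (x / m * m + x % m)  ≡⟨ cong suc (+-comm (x / m * m) (x % m)) ⟩
    suc (x % m + x / m * m)  ≡⟨ cong suc (m≡m%n+[m/n]*n x m) ⟨
    suc x                    ∎
    where open ≡-Reasoning

  block-mono : ∀ {x n} → x ≤ n → block x ≤ block n
  block-mono x≤n = /-monoˡ-≤ m (∸-monoˡ-≤ 1 x≤n)

  blocks : ∀ {k} → Point k → Point k
  blocks = Vec.map block

  offsets : ∀ {k} → Point k → Point k
  offsets = Vec.map offset

  place : ∀ {k} → Point k → Point k → Point k
  place = zipWith (λ b x → b * m + x)

  place-blocks-offsets : ∀ {k n} {p : Point k} → InGrid n p → place (blocks p) (offsets p) ≡ p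
  place-blocks-offsets VecAll.[] = refl
  place-blocks-offsets ((1≤x , _) VecAll.∷ p∈) = cong₂ Vec._∷_ (block*m+offset 1≤x) (place-blocks-offsets p∈)

  place-shift : ∀ {k} (β o : Point k) i d → place β (shift o i d) ≡ shift (place β o) i d
  place-shift (b Vec.∷ β) (x Vec.∷ o) Fin.zero d = cong (Vec._∷ place β o) (sym (+-assoc (b * m) x d))
  place-shift (b Vec.∷ β) (x Vec.∷ o) (Fin.suc i) d = cong ((b * m + x) Vec.∷_) (place-shift β o i d)

  offsets-inGrid : ∀ {k} (p : Point k) → InGrid m (offsets p)
  offsets-inGrid Vec.[] = VecAll.[]
  offsets-inGrid (x Vec.∷ p) = (s≤s ℕ.z≤n , m%n<n (x ∸ 1) m) VecAll.∷ offsets-inGrid p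

  blocks-inRange : ∀ {k n} {p : Point k} → InGrid n p → VecAll.All (_< suc (block n)) (blocks p)
  blocks-inRange VecAll.[] = VecAll.[]
  blocks-inRange ((_ , x≤n) VecAll.∷ p∈) = s≤s (block-mono x≤n) VecAll.∷ blocks-inRange p∈

  _≟ᵖ_ : ∀ {k} → DecidableEquality (Point k)
  _≟ᵖ_ = Vec.≡-dec _≟_

  module _ {k n} (A : GridSubset k n) where

    inBlock : Point k → List (Point k)
    inBlock β = filter (λ p → blocks p ≟ᵖ β) (elems A)

    ∈-inBlock⁻ : ∀ {β p} → p ∈ inBlock β → p ∈ elems A × place β (offsets p) ≡ p
    ∈-inBlock⁻ p∈ with ∈-filter⁻ (λ p → blocks _ ≟ᵖ _) {xs = elems A} p∈
    ... | p∈A , refl = p∈A , place-blocks-offsets (All.lookup (inGrid A) p∈A)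

    slice : Point k → GridSubset k m
    slice β = record
      { elems  = List.map offsets (inBlock β)
      ; unique = unique-map⁺ {g = place β} (All.tabulate (λ p∈ → proj₂ (∈-inBlock⁻ p∈)))
                             (Unique.filter⁺ _ (unique A))
      ; inGrid = map⁺ (All.tabulate (λ {p} _ → offsets-inGrid p))
      }

    slice-cornerFree : CornerFree A → ∀ β → CornerFree (slice β)
    slice-cornerFree cf β (o , d , d>0 , o∈ , corner) with ∈-map⁻ offsets o∈
    ... | p , p∈ , refl = cf (p , d , d>0 , proj₁ (∈-inBlock⁻ p∈) , shifted)
      where
      shifted : ∀ i → shift p i d ∈ elems A
      shifted i with ∈-map⁻ offsets (corner i)
      ... | p′ , p′∈ , shift-eq = subst (_∈ elems A) p′≡shift (proj₁ (∈-inBlock⁻ p′∈))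
        where
        open ≡-Reasoning
        p′≡shift : p′ ≡ shift p i d
        p′≡shift = begin
          p′                                ≡⟨ proj₂ (∈-inBlock⁻ p′∈) ⟨
          place β (offsets p′)              ≡⟨ cong (place β) shift-eq ⟨
          place β (shift (offsets p) i d)   ≡⟨ place-shift β (offsets p) i d ⟩
          shift (place β (offsets p)) i d   ≡⟨ cong (λ q → shift q i d) (proj₂ (∈-inBlock⁻ p∈)) ⟩
          shift p i d                       ∎

    size≤[1+block]^k* : ∀ c → (∀ (B : GridSubset k m) → CornerFree B → size B ≤ c) →
      CornerFree A → size A ≤ suc (block n) ^ k * c
    size≤[1+block]^k* c bound cf = subst (λ N → size A ≤ N * c) (length-vectorsBelow k _)
      (length≤length*fibre blocks _≟ᵖ_ c (vectorsBelow k (suc (block n))) (elems A)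
        (All.map (λ p∈ → ∈-vectorsBelow (blocks-inRange p∈)) (inGrid A))
        (λ β → subst (_≤ c) (length-map offsets (inBlock β)) (bound (slice β) (slice-cornerFree cf β))))

  [1+block]*m<2*n : ∀ {n} → m < n → suc (block n) * m < 2 * n
  [1+block]*m<2*n {n} m<n = begin-strict
    m + block n * m  ≤⟨ +-monoʳ-≤ m (m/n*n≤m (n ∸ 1) m) ⟩
    m + (n ∸ 1)      <⟨ +-mono-<-≤ m<n (m∸n≤m n 1) ⟩
    n + n            ≡⟨ cong (n +_) (+-identityʳ n) ⟨
    2 * n            ∎
    where open ≤-Reasoning

singleton : ∀ {k n} (p : Point k) → InGrid n p → GridSubset k n
singleton p p∈ = record { elems = [ p ] ; unique = All.[] ∷ [] ; inGrid = p∈ All.∷ All.[] }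

singleton-cornerFree : ∀ {k n} (p : Point (suc k)) (p∈ : InGrid n p) → CornerFree (singleton p p∈)
singleton-cornerFree (x Vec.∷ p) _ (_ , d , d>0 , here refl , corner) with corner Fin.zero
... | here x+d∷p≡x∷p = <⇒≢ (m<m+n x d>0) (sym (cong Vec.head x+d∷p≡x∷p))

ones-inGrid : ∀ {k n} → 1 ≤ n → InGrid n (replicate k 1)
ones-inGrid {ℕ.zero}  _   = VecAll.[]
ones-inGrid {suc k} 1≤n = (≤-refl , 1≤n) VecAll.∷ ones-inGrid 1≤n

IsCk-positive : ∀ {k m c} → 1 ≤ k → 1 ≤ m → IsCk k m c → 1 ≤ c
IsCk-positive {suc k} _ 1≤m (_ , maximal) =
  maximal (singleton ones (ones-inGrid 1≤m)) (singleton-cornerFree ones (ones-inGrid 1≤m))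
  where
  ones : Point (suc k)
  ones = replicate (suc k) 1

lemma5 : (k m n cn cm : ℕ) → 1 ≤ k → 1 ≤ m → m < n →
    IsCk k n cn → IsCk k m cm →
    cn * m ^ k < (2 ^ k * cm) * n ^ k
lemma5 k m n cn cm 1≤k 1≤m m<n ((A , cfA , refl) , _) c[m]@(_ , maximal) = begin-strict
  size A * m ^ k       ≤⟨ *-monoˡ-≤ (m ^ k) (size≤[1+block]^k* A cm maximal cfA) ⟩
  q ^ k * cm * m ^ k   ≡⟨ xy∙z≈y∙xz (q ^ k) cm (m ^ k) ⟩
  cm * (q ^ k * m ^ k) ≡⟨ cong (cm *_) (^-distrib-* q m k) ⟨
  cm * (q * m) ^ k     <⟨ *-monoʳ-< cm {{>-nonZero (IsCk-positive 1≤k 1≤m c[m])}}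
                            (^-monoˡ-< k {{>-nonZero 1≤k}} ([1+block]*m<2*n m<n)) ⟩
  cm * (2 * n) ^ k     ≡⟨ cong (cm *_) (^-distrib-* 2 n k) ⟩
  cm * (2 ^ k * n ^ k) ≡⟨ xy∙z≈y∙xz (2 ^ k) cm (n ^ k) ⟨
  2 ^ k * cm * n ^ k   ∎
  where
  open ≤-Reasoning
  open Blocks m {{>-nonZero 1≤m}}
  q : ℕ
  q = suc (block n)
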